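{- If $[Q,t]:A$ is a quantum closure which is in normal form (i.e. there is no distribution $\mathscr D$ with $[Q,t]\mapsto\mathscr D$), then $t$ is a value.
   Context: Fix a finite set of unitary-operator symbols $\mathsf U$, each with an arity $n$ ($\mathsf U_n$). Terms: $t,u,v ::= x \mid r \mid tu \mid \lambda x.t \mid \langle t,u\rangle \mid \mathtt{let}\ \langle x,y\rangle = t\ \mathtt{in}\ u \mid \mathsf{new}\mid \mathsf{tt}\mid\mathsf{ff}\mid \mathsf{meas}\mid \mathsf U \mid \mathtt{if}\ t\ \mathtt{then}\ u\ \mathtt{else}\ v$, $x$ variables, $r$ quantum variables. Types: $A,B::=\mathbb B\mid\mathbb Q\mid A\multimap B\mid A\otimes B$; $A^{\otimes n}$ is the $n$-fold tensor. Judgments $\Theta,V\vdash t:A$ ($\Theta$ finite map variables$\to$types, $V$ finite set of quantum variables); contexts $\Gamma,\Delta$ are such pairs, combined by disjoint union. Rules: $x:A\vdash x:A$; $r\vdash r:\mathbb Q$; $\Gamma,x:A\vdash t:B \Rightarrow \Gamma\vdash\lambda x.t:A\multimap B$; $\Gamma\vdash t:A\multimap B$, $\Delta\vdash u:A\Rightarrow\Gamma,\Delta\vdash tu:B$; $\Gamma\vdash t:A$, $\Delta\vdash u:B\Rightarrow\Gamma,\Delta\vdash\langle t,u\rangle:A\otimes B$; $\Gamma\vdash t:A\otimes B$, $\Delta,x:A,y:B\vdash u:C\Rightarrow\Gamma,\Delta\vdash\mathtt{let}\ \langle x,y\rangle=t\ \mathtt{in}\ u:C$; $\vdash\mathsf{tt}:\mathbb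 B$; $\vdash\mathsf{ff}:\mathbb B$; $\Gamma\vdash t:\mathbb B$, $\vdash u:A$, $\vdash v:A\Rightarrow\Gamma\vdash\mathtt{if}\ t\ \mathtt{then}\ u\ \mathtt{else}\ v:A$; $\vdash\mathsf{new}:\mathbb Q$; $\vdash\mathsf U_n:\mathbb Q^{\otimes n}\multimap\mathbb Q^{\otimes n}$; $\vdash\mathsf{meas}:\mathbb Q\multimap\mathbb B$. Values: $a,b::=r\mid\lambda x.t\mid\langle a,b\rangle\mid\mathsf{new}\mid\mathsf{tt}\mid\mathsf{ff}\mid\mathsf{meas}\mid\mathsf U$. Evaluation contexts: $E::=[\cdot]\mid Et\mid aE\mid\langle E,t\rangle\mid\langle a,E\rangle\mid\mathtt{let}\ \langle x,y\rangle=E\ \mathtt{in}\ t\mid\mathtt{if}\ E\ \mathtt{then}\ t\ \mathtt{else}\ u$. For a finite set $X$, $\mathbb H(X)$ is the Hilbert space with basis $X$ and $\mathcal{SUB}(X)$ the set of functions $X\to\{0,1\}$. A quantum closure of type $A$, written $[Q,t]:A$, is a pair with $Q$ a normalized vector of $\mathbb H(\mathcal{SUB}(V))$ and $V\vdash t:A$ (no term variables). A distribution is a function from closures to $[0,1]$ with total mass $\le1$; $\{C_1^{p_1},\dots,C_n^{p_n}\}$ denotes a finite one. $\mathcal J^r_b(Q)$ is the projection of $Q$ onto the subspace where $r$ is $b$, and $\mathcal R^r_b(Q)$ the probability of observing $b$ when measuring $r$. One-step reduction $\mapsto$: $[Q,E[(\lambda x.t)u]]\mapsto\{[Q,E[t\{u/x\}]]^1\}$;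 $[Q,E[\mathtt{let}\ \langle x,y\rangle=\langle t,u\rangle\ \mathtt{in}\ v]]\mapsto\{[Q,E[v\{t/x,u/y\}]]^1\}$; $[Q,E[\mathtt{if}\ \mathsf{tt}\ \mathtt{then}\ t\ \mathtt{else}\ u]]\mapsto\{[Q,E[t]]^1\}$; same with $\mathsf{ff}$ giving $E[u]$; $[Q,E[\mathsf{new}]]\mapsto\{[Q\otimes|r\leftarrow0\rangle,E[r]]^1\}$ for fresh $r$; $[Q,E[\mathsf U_n\langle r_1,\dots,r_n\rangle]]\mapsto\{[\mathsf U_n^{r_1,\dots,r_n}(Q),E[\langle r_1,\dots,r_n\rangle]]^1\}$; $[Q,E[\mathsf{meas}\ r]]\mapsto\{[\mathcal J^r_0(Q),E[\mathsf{tt}]]^{\mathcal R^r_0(Q)},[\mathcal J^r_1(Q),E[\mathsf{ff}]]^{\mathcal R^r_1(Q)}\}$. -}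

module Defs where

open import Data.Nat using (ℕ; zero; suc; _≡ᵇ_)
open import Data.Bool using (Bool; true; false; if_then_else_)
open import Data.Fin using (Fin)
open import Data.Maybe using (Maybe; just; nothing)
open import Data.Vec using (Vec; []; _∷_)
open import Data.List using (List; []; _∷_)
open import Data.Product using (_×_; _,_)
open import Data.Sum using (_⊎_)
open import Relation.Binary.PropositionalEquality using (_≡_; _≢_)

-- Sets of quantum variables are represented by their characteristic
-- functions ℕ → Bool (derivable ones are automatically finite).
QSet : Set
QSet = ℕ → Bool

addQ : QSet → ℕ → QSet
addQ V r s = if s ≡ᵇ r then true else V s

-- Abstract model of the quantum register.
-- k unitary symbols; symbol u has arity suc (ar u) ≥ 1.
record QModel (k : ℕ) (ar : Fin k → ℕ) : Set₁ where
  field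
    Prob     : Set                       -- probabilities (values in [0,1])
    one      : Prob
    State    : QSet → Set                -- normalized vectors of H(SUB(V))
    -- Q ⊗ |r ← 0⟩
    addQubit : ∀ {V} (r : ℕ) → State V → State (addQ V r)
    applyU   : ∀ {V} (u : Fin k) → Vec ℕ (suc (ar u)) → State V → State V
    -- J^r_b(Q)   (b = false means 0, b = true means 1)
    project  : ∀ {V} (r : ℕ) (b : Bool) → State V → State V
    measProb : ∀ {V} (r : ℕ) (b : Bool) → State V → Prob

module Lang (k : ℕ) (ar : Fin k → ℕ) (M : QModel k ar) where
  open QModel M

  infixr 6 _⊸_
  infixr 7 _⊗_

  data Ty : Set where
    bit   : Ty
    qubit : Ty
    _⊸_   : Ty → Ty → Ty
    _⊗_   : Ty → Ty → Ty

  QTensor : ℕ → Ty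
  QTensor zero    = qubit
  QTensor (suc m) = qubit ⊗ QTensor m

  data Term : Set where
    var  : ℕ → Term
    qvar : ℕ → Term
    app  : Term → Term → Term
    lam  : ℕ → Term → Term
    pair : Term → Term → Term
    letp : ℕ → ℕ → Term → Term → Term
    new  : Term
    tt   : Term
    ff   : Term
    meas : Term
    uop  : Fin k → Term
    ite  : Term → Term → Term → Term

  qtuple : ∀ {m} → Vec ℕ (suc m) → Term
  qtuple {zero}  (r ∷ [])      = qvar r
  qtuple {suc m} (r ∷ r' ∷ rs) = pair (qvar r) (qtuple (r' ∷ rs))

  Sub : Set
  Sub = ℕ → Term

  update : Sub → ℕ → Term → Sub
  update σ x t y = if y ≡ᵇ x then t else σ y

  idSub : Sub
  idSub = var

  subst : Sub → Term → Term
  subst σ (var x)        = σ x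
  subst σ (qvar r)       = qvar r
  subst σ (app t u)      = app (subst σ t) (subst σ u)
  subst σ (lam x t)      = lam x (subst (update σ x (var x)) t)
  subst σ (pair t u)     = pair (subst σ t) (subst σ u)
  subst σ (letp x y t u) = letp x y (subst σ t) (subst (update (update σ x (var x)) y (var y)) u)
  subst σ new            = new
  subst σ tt             = tt
  subst σ ff             = ff
  subst σ meas           = meas
  subst σ (uop u)        = uop u
  subst σ (ite t u v)    = ite (subst σ t) (subst σ u) (subst σ v)

  subst1 : ℕ → Term → Term → Term
  subst1 x u t = subst (update idSub x u) t

  subst2 : ℕ → Term → ℕ → Term → Term → Term
  subst2 x t y u v = subst (update (update idSub y u) x t) v

  data IsValue : Term → Set where
    v-qvar : ∀ {r} → IsValue (qvar r)
    v-lam  : ∀ {x t} → IsValue (lam x t)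
    v-pair : ∀ {a b} → IsValue a → IsValue b → IsValue (pair a b)
    v-new  : IsValue new
    v-tt   : IsValue tt
    v-ff   : IsValue ff
    v-meas : IsValue meas
    v-uop  : ∀ {u} → IsValue (uop u)

  data EvCtx : Set where
    hole  : EvCtx
    appL  : EvCtx → Term → EvCtx
    appR  : (a : Term) → IsValue a → EvCtx → EvCtx
    pairL : EvCtx → Term → EvCtx
    pairR : (a : Term) → IsValue a → EvCtx → EvCtx
    letE  : ℕ → ℕ → EvCtx → Term → EvCtx
    iteE  : EvCtx → Term → Term → EvCtx

  plug : EvCtx → Term → Term
  plug hole          s = s
  plug (appL E t)    s = app (plug E s) t
  plug (appR a _ E)  s = app a (plug E s)
  plug (pairL E t)   s = pair (plug E s) t
  plug (pairR a _ E) s = pair a (plug E s)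
  plug (letE x y E t) s = letp x y (plug E s) t
  plug (iteE E t u)  s = ite (plug E s) t u

  -- typing contexts: Θ as partial map, V as characteristic function
  TCtx : Set
  TCtx = ℕ → Maybe Ty

  ∅Θ : TCtx
  ∅Θ _ = nothing

  EmptyΘ : TCtx → Set
  EmptyΘ Θ = ∀ x → Θ x ≡ nothing

  EmptyV : QSet → Set
  EmptyV V = ∀ r → V r ≡ false

  Extend : TCtx → ℕ → Ty → TCtx → Set
  Extend Θ x A Θ' = (Θ x ≡ nothing) × (Θ' x ≡ just A) × (∀ y → y ≢ x → Θ' y ≡ Θ y)

  SplitΘ : TCtx → TCtx → TCtx → Set
  SplitΘ Θ Θ₁ Θ₂ = ∀ x → ((Θ x ≡ Θ₁ x) × (Θ₂ x ≡ nothing)) ⊎ ((Θ x ≡ Θ₂ x) × (Θ₁ x ≡ nothing))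

  SplitV : QSet → QSet → QSet → Set
  SplitV V V₁ V₂ = ∀ r → ((V r ≡ V₁ r) × (V₂ r ≡ false)) ⊎ ((V r ≡ V₂ r) × (V₁ r ≡ false))

  infix 4 _⨾_⊢_∶_
  data _⨾_⊢_∶_ : TCtx → QSet → Term → Ty → Set where
    t-var  : ∀ {Θ V x A} → Θ x ≡ just A → (∀ y → y ≢ x → Θ y ≡ nothing) → EmptyV V
           → Θ ⨾ V ⊢ var x ∶ A
    t-qvar : ∀ {Θ V r} → EmptyΘ Θ → V r ≡ true → (∀ s → s ≢ r → V s ≡ false)
           → Θ ⨾ V ⊢ qvar r ∶ qubit
    t-lam  : ∀ {Θ Θ' V x t A B} → Extend Θ x A Θ' → Θ' ⨾ V ⊢ t ∶ B
           → Θ ⨾ V ⊢ lam x t ∶ A ⊸ B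
    t-app  : ∀ {Θ Θ₁ Θ₂ V V₁ V₂ t u A B} → SplitΘ Θ Θ₁ Θ₂ → SplitV V V₁ V₂
           → Θ₁ ⨾ V₁ ⊢ t ∶ A ⊸ B → Θ₂ ⨾ V₂ ⊢ u ∶ A
           → Θ ⨾ V ⊢ app t u ∶ B
    t-pair : ∀ {Θ Θ₁ Θ₂ V V₁ V₂ t u A B} → SplitΘ Θ Θ₁ Θ₂ → SplitV V V₁ V₂
           → Θ₁ ⨾ V₁ ⊢ t ∶ A → Θ₂ ⨾ V₂ ⊢ u ∶ B
           → Θ ⨾ V ⊢ pair t u ∶ A ⊗ B
    t-let  : ∀ {Θ Θ₁ Θ₂ Θ₂' Θ₂'' V V₁ V₂ x y t u A B C}
           → SplitΘ Θ Θ₁ Θ₂ → SplitV V V₁ V₂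
           → Θ₁ ⨾ V₁ ⊢ t ∶ A ⊗ B
           → Extend Θ₂ x A Θ₂' → Extend Θ₂' y B Θ₂''
           → Θ₂'' ⨾ V₂ ⊢ u ∶ C
           → Θ ⨾ V ⊢ letp x y t u ∶ C
    t-tt   : ∀ {Θ V} → EmptyΘ Θ → EmptyV V → Θ ⨾ V ⊢ tt ∶ bit
    t-ff   : ∀ {Θ V} → EmptyΘ Θ → EmptyV V → Θ ⨾ V ⊢ ff ∶ bit
    t-ite  : ∀ {Θ V Θ₁ V₁ Θ₂ V₂ t u v A} → Θ ⨾ V ⊢ t ∶ bit
           → EmptyΘ Θ₁ → EmptyV V₁ → Θ₁ ⨾ V₁ ⊢ u ∶ A
           → EmptyΘ Θ₂ → EmptyV V₂ → Θ₂ ⨾ V₂ ⊢ v ∶ A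
           → Θ ⨾ V ⊢ ite t u v ∶ A
    t-new  : ∀ {Θ V} → EmptyΘ Θ → EmptyV V → Θ ⨾ V ⊢ new ∶ qubit
    t-uop  : ∀ {Θ V u} → EmptyΘ Θ → EmptyV V
           → Θ ⨾ V ⊢ uop u ∶ QTensor (ar u) ⊸ QTensor (ar u)
    t-meas : ∀ {Θ V} → EmptyΘ Θ → EmptyV V → Θ ⨾ V ⊢ meas ∶ qubit ⊸ bit

  -- (untyped) quantum closures [Q, t]
  record Closure : Set where
    constructor ⟦_,_⟧
    field
      {qs}  : QSet
      state : State qs
      term  : Term

  Dist : Set
  Dist = List (Closure × Prob)

  infix 3 _↦_
  data _↦_ : Closure → Dist → Set where
    s-beta : ∀ {V} {Q : State V} E x t u
           → ⟦ Q , plug E (app (lam x t) u) ⟧ ↦ (⟦ Q , plug E (subst1 x u t) ⟧ , one) ∷ []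
    s-let  : ∀ {V} {Q : State V} E x y t u v
           → ⟦ Q , plug E (letp x y (pair t u) v) ⟧ ↦ (⟦ Q , plug E (subst2 x t y u v) ⟧ , one) ∷ []
    s-iftt : ∀ {V} {Q : State V} E t u
           → ⟦ Q , plug E (ite tt t u) ⟧ ↦ (⟦ Q , plug E t ⟧ , one) ∷ []
    s-ifff : ∀ {V} {Q : State V} E t u
           → ⟦ Q , plug E (ite ff t u) ⟧ ↦ (⟦ Q , plug E u ⟧ , one) ∷ []
    s-new  : ∀ {V} {Q : State V} E r → V r ≡ false
           → ⟦ Q , plug E new ⟧ ↦ (⟦ addQubit r Q , plug E (qvar r) ⟧ , one) ∷ []
    s-uop  : ∀ {V} {Q : State V} E u (rs : Vec ℕ (suc (ar u)))
           → ⟦ Q , plug E (app (uop u) (qtuple rs)) ⟧ ↦ (⟦ applyU u rs Q , plug E (qtuple rs) ⟧ , one) ∷ []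
    s-meas : ∀ {V} {Q : State V} E r
           → ⟦ Q , plug E (app meas (qvar r)) ⟧
             ↦ (⟦ project r false Q , plug E tt ⟧ , measProb r false Q)
               ∷ (⟦ project r true Q , plug E ff ⟧ , measProb r true Q) ∷ []

-- Progress: a closed well-typed term is either a value or of the form E[s]
-- for a redex s.  Canonical forms make every elimination applied to values
-- a redex, except that the argument of meas or of a unitary may still
-- contain new, which is then the redex.  Each redex reduces; for new this
-- needs a fresh quantum variable, which exists because the quantum variables
-- of a typing judgement are finitely many.
module Submission where

open import Defs
open import Data.Nat using (ℕ; suc; _≤_; _⊔_)
open import Data.Nat.Properties using (≤-trans; ≤-refl; m≤m⊔n; m≤n⊔m; <⇒≢)
open import Data.Fin using (Fin)
open import Data.Vec using (Vec; []; _∷_)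
open import Data.Product using (∃-syntax; _,_)
open import Data.Sum using (inj₁; inj₂)
open import Data.Bool using (false)
open import Data.Empty using (⊥-elim)
open import Relation.Nullary using (¬_)
open import Relation.Binary.PropositionalEquality using (_≡_; refl; sym; trans)

module _ (k : ℕ) (ar : Fin k → ℕ) (M : QModel k ar) where
  open Lang k ar M
  open QModel M

  BoundedSupport : QSet → Set
  BoundedSupport V = ∃[ n ] (∀ s → n ≤ s → V s ≡ false)

  EmptyV-bounded : ∀ {V} → EmptyV V → BoundedSupport V
  EmptyV-bounded empty = 0 , λ s _ → empty s

  SplitV-bounded : ∀ {V V₁ V₂} → SplitV V V₁ V₂ →
                   BoundedSupport V₁ → BoundedSupport V₂ → BoundedSupport V
  SplitV-bounded {V} split (n₁ , b₁) (n₂ , b₂) = n₁ ⊔ n₂ , bound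
    where
    bound : ∀ s → n₁ ⊔ n₂ ≤ s → V s ≡ false
    bound s n≤s with split s
    ... | inj₁ (V≡V₁ , _) = trans V≡V₁ (b₁ s (≤-trans (m≤m⊔n n₁ n₂) n≤s))
    ... | inj₂ (V≡V₂ , _) = trans V≡V₂ (b₂ s (≤-trans (m≤n⊔m n₁ n₂) n≤s))

  ⊢-bounded : ∀ {Θ V t A} → Θ ⨾ V ⊢ t ∶ A → BoundedSupport V
  ⊢-bounded (t-var _ _ e)             = EmptyV-bounded e
  ⊢-bounded (t-qvar {r = r} _ _ only) = suc r , λ s r<s → only s (λ s≡r → <⇒≢ r<s (sym s≡r))
  ⊢-bounded (t-lam _ d)               = ⊢-bounded d
  ⊢-bounded (t-app _ sp d₁ d₂)        = SplitV-bounded sp (⊢-bounded d₁) (⊢-bounded d₂)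
  ⊢-bounded (t-pair _ sp d₁ d₂)       = SplitV-bounded sp (⊢-bounded d₁) (⊢-bounded d₂)
  ⊢-bounded (t-let _ sp d₁ _ _ d₂)    = SplitV-bounded sp (⊢-bounded d₁) (⊢-bounded d₂)
  ⊢-bounded (t-tt _ e)                = EmptyV-bounded e
  ⊢-bounded (t-ff _ e)                = EmptyV-bounded e
  ⊢-bounded (t-ite d _ _ _ _ _ _)     = ⊢-bounded d
  ⊢-bounded (t-new _ e)               = EmptyV-bounded e
  ⊢-bounded (t-uop _ e)               = EmptyV-bounded e
  ⊢-bounded (t-meas _ e)              = EmptyV-bounded e

  EmptyΘ-splitˡ : ∀ {Θ Θ₁ Θ₂} → SplitΘ Θ Θ₁ Θ₂ → EmptyΘ Θ → EmptyΘ Θ₁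
  EmptyΘ-splitˡ split empty x with split x
  ... | inj₁ (Θ≡Θ₁ , _) = trans (sym Θ≡Θ₁) (empty x)
  ... | inj₂ (_ , Θ₁x)  = Θ₁x

  EmptyΘ-splitʳ : ∀ {Θ Θ₁ Θ₂} → SplitΘ Θ Θ₁ Θ₂ → EmptyΘ Θ → EmptyΘ Θ₂
  EmptyΘ-splitʳ split empty x with split x
  ... | inj₁ (_ , Θ₂x)  = Θ₂x
  ... | inj₂ (Θ≡Θ₂ , _) = trans (sym Θ≡Θ₂) (empty x)

  data Redex : Term → Set where
    beta  : ∀ x t u → Redex (app (lam x t) u)
    let-β : ∀ x y t u v → Redex (letp x y (pair t u) v)
    if-tt : ∀ t u → Redex (ite tt t u)
    if-ff : ∀ t u → Redex (ite ff t u)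
    new   : Redex new
    unit  : ∀ u (rs : Vec ℕ (suc (ar u))) → Redex (app (uop u) (qtuple rs))
    meas  : ∀ r → Redex (app meas (qvar r))

  Redex-reduces : ∀ {V} (Q : State V) → BoundedSupport V →
                  ∀ {s} → Redex s → (E : EvCtx) → ∃[ D ] (⟦ Q , plug E s ⟧ ↦ D)
  Redex-reduces Q _       (beta x t u)      E = _ , s-beta E x t u
  Redex-reduces Q _       (let-β x y t u v) E = _ , s-let E x y t u v
  Redex-reduces Q _       (if-tt t u)       E = _ , s-iftt E t u
  Redex-reduces Q _       (if-ff t u)       E = _ , s-ifff E t u
  Redex-reduces Q (n , b) new               E = _ , s-new E n (b n ≤-refl)
  Redex-reduces Q _       (unit u rs)       E = _ , s-uop E u rs
  Redex-reduces Q _       (meas r)          E = _ , s-meas E r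

  data Progress : Term → Set where
    done : ∀ {t} → IsValue t → Progress t
    step : ∀ E {s} → Redex s → Progress (plug E s)

  data QTupleValue (m : ℕ) : Term → Set where
    tuple     : (rs : Vec ℕ (suc m)) → QTupleValue m (qtuple rs)
    new-under : ∀ E → QTupleValue m (plug E new)

  QTensor-canonical : ∀ m {Θ V a} → IsValue a → Θ ⨾ V ⊢ a ∶ QTensor m → QTupleValue m a
  QTensor-canonical 0 v-qvar (t-qvar _ _ _) = tuple (_ ∷ [])
  QTensor-canonical 0 v-new  _              = new-under hole
  QTensor-canonical 0 v-lam  ()
  QTensor-canonical 0 (v-pair _ _) ()
  QTensor-canonical 0 v-tt   ()
  QTensor-canonical 0 v-ff   ()
  QTensor-canonical 0 v-meas ()
  QTensor-canonical 0 v-uop  ()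
  QTensor-canonical (suc m) (v-pair va vb) (t-pair _ _ da db) with QTensor-canonical 0 va da
  ... | new-under E = new-under (pairL E _)
  ... | tuple (r ∷ []) with QTensor-canonical m vb db
  ...   | new-under E     = new-under (pairR (qvar r) v-qvar E)
  ...   | tuple (r′ ∷ rs) = tuple (r ∷ r′ ∷ rs)

  app-progress : ∀ {Θ₁ V₁ Θ₂ V₂ t u A B} → IsValue t → Θ₁ ⨾ V₁ ⊢ t ∶ A ⊸ B →
                 IsValue u → Θ₂ ⨾ V₂ ⊢ u ∶ A → Progress (app t u)
  app-progress v-lam (t-lam _ _) _ _ = step hole (beta _ _ _)
  app-progress v-meas (t-meas _ _) vu du with QTensor-canonical 0 vu du
  ... | tuple (r ∷ []) = step hole (meas r)
  ... | new-under E    = step (appR meas v-meas E) new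
  app-progress (v-uop {u}) (t-uop _ _) vu du with QTensor-canonical (ar u) vu du
  ... | tuple rs    = step hole (unit u rs)
  ... | new-under E = step (appR (uop u) v-uop E) new
  app-progress v-qvar ()
  app-progress (v-pair _ _) ()
  app-progress v-new ()
  app-progress v-tt ()
  app-progress v-ff ()

  let-progress : ∀ {Θ V t A B x y u} → IsValue t → Θ ⨾ V ⊢ t ∶ A ⊗ B →
                 Progress (letp x y t u)
  let-progress (v-pair _ _) _ = step hole (let-β _ _ _ _ _)
  let-progress v-qvar ()
  let-progress v-lam ()
  let-progress v-new ()
  let-progress v-tt ()
  let-progress v-ff ()
  let-progress v-meas ()
  let-progress v-uop ()

  ite-progress : ∀ {Θ V t u v} → IsValue t → Θ ⨾ V ⊢ t ∶ bit → Progress (ite t u v)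
  ite-progress v-tt _ = step hole (if-tt _ _)
  ite-progress v-ff _ = step hole (if-ff _ _)
  ite-progress v-qvar ()
  ite-progress v-lam ()
  ite-progress (v-pair _ _) ()
  ite-progress v-new ()
  ite-progress v-meas ()
  ite-progress v-uop ()

  progress : ∀ {Θ V t A} → EmptyΘ Θ → Θ ⨾ V ⊢ t ∶ A → Progress t
  progress empty (t-var {x = x} Θx _ _) with trans (sym Θx) (empty x)
  ... | ()
  progress empty (t-qvar _ _ _) = done v-qvar
  progress empty (t-lam _ _)    = done v-lam
  progress empty (t-app sp _ d₁ d₂) with progress (EmptyΘ-splitˡ sp empty) d₁
  ... | step E r = step (appL E _) r
  ... | done vt with progress (EmptyΘ-splitʳ sp empty) d₂
  ...   | step E r = step (appR _ vt E) r
  ...   | done vu  = app-progress vt d₁ vu d₂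
  progress empty (t-pair sp _ d₁ d₂) with progress (EmptyΘ-splitˡ sp empty) d₁
  ... | step E r = step (pairL E _) r
  ... | done vt with progress (EmptyΘ-splitʳ sp empty) d₂
  ...   | step E r = step (pairR _ vt E) r
  ...   | done vu  = done (v-pair vt vu)
  progress empty (t-let sp _ d₁ _ _ _) with progress (EmptyΘ-splitˡ sp empty) d₁
  ... | step E r = step (letE _ _ E _) r
  ... | done vt  = let-progress vt d₁
  progress empty (t-ite d _ _ _ _ _ _) with progress empty d
  ... | step E r = step (iteE E _ _) r
  ... | done vt  = ite-progress vt d
  progress empty (t-tt _ _)   = done v-tt
  progress empty (t-ff _ _)   = done v-ff
  progress empty (t-new _ _)  = done v-new
  progress empty (t-uop _ _)  = done v-uop
  progress empty (t-meas _ _) = done v-meas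

  normal-form⇒value : ∀ {V} (Q : State V) {t A} → ∅Θ ⨾ V ⊢ t ∶ A →
                      (∀ D → ¬ (⟦ Q , t ⟧ ↦ D)) → IsValue t
  normal-form⇒value Q d normal with progress (λ _ → refl) d
  ... | done v   = v
  ... | step E r with Redex-reduces Q (⊢-bounded d) r E
  ...   | D , s↦D = ⊥-elim (normal D s↦D)

mainTheorem16 : (k : ℕ) (ar : Fin k → ℕ) (M : QModel k ar) →
    let open Lang k ar M in
    ∀ {V : QSet} (Q : QModel.State M V) (t : Term) (A : Ty) →
    ∅Θ ⨾ V ⊢ t ∶ A →
    (∀ (D : Dist) → ¬ (⟦ Q , t ⟧ ↦ D)) →
    IsValue t
mainTheorem16 k ar M Q t A = normal-form⇒value k ar M Q
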